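{- Let $G$ be a finite abelian group of exponent greater than $2$ with inversion $\iota$, and let $S$ be an inverse-closed subset of $G$ such that $\mathrm{Cay}(G,S)$ is connected, non-bipartite and twin-free and $B(S)=N_{B(S)}(R(G))=R(G)\rtimes\langle\iota\rangle$. Then $\mathrm{Aut}(D(\mathrm{Cay}(G,S)))=(R(G)\rtimes\langle\iota\rangle)\times C_2$, and so $\mathrm{Cay}(G,S)$ is stable.
   Context: $\mathrm{Cay}(G,S)$ has vertex set $G$, $x\sim y$ iff $yx^{ -1}\in S$. Twin-free: no two distinct vertices have the same neighbourhood. $D(\Gamma)$ is the graph on $V\times\{0,1\}$ with $(u,x)\sim(v,y)$ iff $u\sim v$ and $x\ne y$. $R(g)$ is $x\mapsto xg$, $R(G)=\{R(g)\}$; permutations $\alpha$ of $G$ are identified with $(g,i)\mapsto(g^\alpha,i)$ on $G\times\{0,1\}$. $B(S)$ is the setwise stabilizer of $G\times\{0\}$ in $\mathrm{Aut}(D(\mathrm{Cay}(G,S)))$. $(R(G)\rtimes\langle\iota\rangle)\times C_2$ is the subgroup generated by $R(G)$, $\iota$ and the swap $(g,i)\mapsto(g,1-i)$. A graph $\Gamma$ is stable if $\mathrm{Aut}(D(\Gamma))=\mathrm{Aut}(\Gamma)\times\mathrm{Aut}(K_2)$. -}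

module Defs where

open import Data.Nat using (ℕ)
open import Data.Fin using (Fin)
open import Data.Fin.Subset using (Subset; _∈_)
open import Data.Bool using (Bool; true; false; if_then_else_; _xor_)
open import Data.Product using (Σ; _×_; _,_; proj₁; proj₂; ∃; ∃-syntax)
open import Data.Empty using (⊥)
open import Relation.Nullary using (¬_)
open import Relation.Binary.PropositionalEquality using (_≡_; _≢_)
open import Relation.Binary.Construct.Closure.ReflexiveTransitive using (Star)
open import Algebra.Structures using (IsAbelianGroup)
open import Function.Bundles using (_↔_; _⇔_; Inverse)

-- A finite abelian group, presented (up to isomorphism) on the carrier Fin n.
record FinAbGroup : Set where
  field
    order : ℕ
    _∙_   : Fin order → Fin order → Fin order
    ε     : Fin order
    _⁻¹   : Fin order → Fin order
    isAbelianGroup : IsAbelianGroup _≡_ _∙_ ε _⁻¹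

Perm : Set → Set
Perm V = V ↔ V

IsAut : {V : Set} → (V → V → Set) → Perm V → Set
IsAut {V} Adj φ = ∀ (u v : V) → Adj u v ⇔ Adj (Inverse.to φ u) (Inverse.to φ v)

-- Canonical double cover D(Γ) on V × {0,1}  (false = 0, true = 1).
DAdj : {V : Set} → (V → V → Set) → V × Bool → V × Bool → Set
DAdj Adj (u , x) (v , y) = Adj u v × (x ≢ y)

Connected : {V : Set} → (V → V → Set) → Set
Connected {V} Adj = ∀ (x y : V) → Star Adj x y

Bipartite : {V : Set} → (V → V → Set) → Set
Bipartite {V} Adj = Σ (V → Bool) λ c → (∀ (x y : V) → Adj x y → c x ≢ c y)

TwinFree : {V : Set} → (V → V → Set) → Set
TwinFree {V} Adj =
  ∀ (x y : V) → (∀ z → (Adj x z → Adj y z) × (Adj y z → Adj x z)) → x ≡ y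

module _ (G : FinAbGroup) where
  open FinAbGroup G

  V : Set
  V = Fin order

  -- exponent > 2  iff  some element has order > 2  iff  some g with g² ≠ e
  ExponentGt2 : Set
  ExponentGt2 = ∃[ g ] (g ∙ g ≢ ε)

  InverseClosed : Subset order → Set
  InverseClosed S = ∀ s → s ∈ S → (s ⁻¹) ∈ S

  CayAdj : Subset order → V → V → Set
  CayAdj S x y = (y ∙ (x ⁻¹)) ∈ S

  Rg : V → V × Bool → V × Bool
  Rg g (x , i) = (x ∙ g , i)

  ιpow : Bool → V → V
  ιpow b x = if b then x ⁻¹ else x

  -- φ ∈ B(S): automorphism of D(Cay(G,S)) fixing G × {0} setwise
  InB : Subset order → Perm (V × Bool) → Set
  InB S φ = IsAut (DAdj (CayAdj S)) φ
          × (∀ g → proj₂ (Inverse.to φ (g , false)) ≡ false)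
          × (∀ g → proj₂ (Inverse.from φ (g , false)) ≡ false)

  NormalisesR : Perm (V × Bool) → Set
  NormalisesR φ =
      (∀ g → ∃[ h ] (∀ p → Inverse.to φ (Rg g (Inverse.from φ p)) ≡ Rg h p))
    × (∀ h → ∃[ g ] (∀ p → Inverse.to φ (Rg g (Inverse.from φ p)) ≡ Rg h p))

  -- φ ∈ R(G) ⋊ ⟨ι⟩ (acting identically on both layers): (x,i) ↦ (ι^b(x) h, i)
  InRι : Perm (V × Bool) → Set
  InRι φ = ∃[ h ] ∃[ b ] (∀ x i → Inverse.to φ (x , i) ≡ (ιpow b x ∙ h , i))

  InRιC2 : Perm (V × Bool) → Set
  InRιC2 φ = ∃[ h ] ∃[ b ] ∃[ c ] (∀ x i → Inverse.to φ (x , i) ≡ (ιpow b x ∙ h , i xor c))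

-- Stability: Aut(D(Γ)) = Aut(Γ) × Aut(K₂), with Aut(K₂) = {id, swap} = {i ↦ i xor c}
InAutΓ×AutK2 : {V : Set} → (V → V → Set) → Perm (V × Bool) → Set
InAutΓ×AutK2 {V} Adj φ =
  ∃[ σ ] IsAut Adj σ × ∃[ c ] (∀ (x : V) i → Inverse.to φ (x , i) ≡ (Inverse.to σ x , i xor c))

Stable : {V : Set} → (V → V → Set) → Set
Stable {V} Adj =
    (∀ φ → IsAut (DAdj Adj) φ → InAutΓ×AutK2 Adj φ)
  × (∀ φ → InAutΓ×AutK2 Adj φ → IsAut (DAdj Adj) φ)

{-# OPTIONS --safe #-}
-- Call p₂ ∈ {0,1} the layer of a vertex p of D(Γ). For an automorphism φ of D(Γ), the
-- layer shift  layer (φ p) xor layer p  takes equal values at the two ends of every edge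
-- of D(Γ); when Γ is connected and non-bipartite every such function is constant.
-- Composing φ with the swap by that constant gives an automorphism fixing both layers,
-- i.e. an element of B(S) = R(G) ⋊ ⟨ι⟩. Conversely an element of (R(G) ⋊ ⟨ι⟩) × C₂ is
-- such an element composed with a swap, hence an automorphism. Finally an automorphism
-- of the form (x , i) ↦ (f x , i xor c) of D(Γ) restricts to the automorphism f of Γ.
module Submission where

open import Defs
open import Data.Bool using (Bool; true; false; not; _xor_)
open import Data.Bool.Properties
  using (not-¬; ¬-not; not-distribˡ-xor; not-distribʳ-xor; xor-assoc; xor-comm; xor-same; xor-identityʳ)
open import Data.Empty using (⊥-elim)
open import Data.Fin.Subset using (Subset)
open import Data.Product using (_×_; _,_; proj₁; proj₂)
open import Data.Product.Function.NonDependent.Propositional using (_×-⇔_)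
open import Function.Bundles using (Inverse; Equivalence; _⇔_; mk⇔; mk↔ₛ′)
open import Function.Construct.Composition using (_↔-∘_)
open import Function.Construct.Identity using (↔-id)
open import Function.Properties.Equivalence using () renaming (refl to ⇔-refl; sym to ⇔-sym; trans to ⇔-trans)
open import Relation.Binary.Construct.Closure.ReflexiveTransitive using (fold)
open import Relation.Binary.PropositionalEquality
  using (_≡_; _≢_; refl; sym; trans; cong; cong₂; module ≡-Reasoning)
open import Relation.Nullary using (¬_)

open Inverse using (to; from; strictlyInverseˡ; strictlyInverseʳ)
open ≡-Reasoning

xor-cancelˡ : ∀ a b → a xor (a xor b) ≡ b
xor-cancelˡ a b = begin
  a xor (a xor b)  ≡⟨ xor-assoc a a b ⟨
  (a xor a) xor b  ≡⟨ cong (_xor b) (xor-same a) ⟩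
  b                ∎

xor-cancelʳ : ∀ a b → (b xor a) xor a ≡ b
xor-cancelʳ a b = begin
  (b xor a) xor a  ≡⟨ xor-assoc b a a ⟩
  b xor (a xor a)  ≡⟨ cong (b xor_) (xor-same a) ⟩
  b xor false      ≡⟨ xor-identityʳ b ⟩
  b                ∎

xor-cancelʳ-≡ : ∀ a b c → b xor a ≡ c xor a → b ≡ c
xor-cancelʳ-≡ a b c eq = begin
  b                ≡⟨ xor-cancelʳ a b ⟨
  (b xor a) xor a  ≡⟨ cong (_xor a) eq ⟩
  (c xor a) xor a  ≡⟨ xor-cancelʳ a c ⟩
  c                ∎

not-xor : ∀ a b → not a xor b ≡ a xor not b
not-xor a b = trans (sym (not-distribˡ-xor a b)) (not-distribʳ-xor a b)

from-invariant : ∀ {A B : Set} (φ : Perm A) (l : A → B)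
  → (∀ p → l (to φ p) ≡ l p) → ∀ q → l (from φ q) ≡ l q
from-invariant φ l invariant q = begin
  l (from φ q)         ≡⟨ invariant (from φ q) ⟨
  l (to φ (from φ q))  ≡⟨ cong l (strictlyInverseˡ φ q) ⟩
  l q                  ∎

swapLayers : {V : Set} → Bool → Perm (V × Bool)
swapLayers c = mk↔ₛ′ flipLayer flipLayer involutive involutive
  where
  flipLayer : _ × Bool → _ × Bool
  flipLayer (x , i) = x , i xor c
  involutive : ∀ p → flipLayer (flipLayer p) ≡ p
  involutive (x , i) = cong (x ,_) (xor-cancelʳ c i)

swapLayers-involutive : {V : Set} (c : Bool) (p : V × Bool)
  → to (swapLayers c) (to (swapLayers c) p) ≡ p
swapLayers-involutive c p = strictlyInverseˡ (swapLayers c) p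

layerShift : {V : Set} → Perm (V × Bool) → V × Bool → Bool
layerShift φ p = proj₂ (to φ p) xor proj₂ p

module _ {V : Set} {_~_ : V → V → Set} where

  IsAut-∘ : ∀ {φ ψ} → IsAut _~_ φ → IsAut _~_ ψ → IsAut _~_ (ψ ↔-∘ φ)
  IsAut-∘ φ-aut ψ-aut u v = ⇔-trans (φ-aut u v) (ψ-aut _ _)

  IsAut-cancelˡ : ∀ {φ ψ} → IsAut _~_ ψ → IsAut _~_ (ψ ↔-∘ φ) → IsAut _~_ φ
  IsAut-cancelˡ ψ-aut ψφ-aut u v = ⇔-trans (ψφ-aut u v) (⇔-sym (ψ-aut _ _))

  DAdj-across : ∀ {x y} i → x ~ y ⇔ DAdj _~_ (x , i) (y , not i)
  DAdj-across i = mk⇔ (_, not-¬ refl) proj₁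

  InAutΓ×AutK2⇒IsAut : ∀ φ → InAutΓ×AutK2 _~_ φ → IsAut (DAdj _~_) φ
  InAutΓ×AutK2⇒IsAut _ (σ , σ-aut , c , φ≗σ×c) (x , i) (y , j)
    rewrite φ≗σ×c x i | φ≗σ×c y j =
      σ-aut x y ×-⇔ mk⇔ (λ i≢j e → i≢j (xor-cancelʳ-≡ c i j e)) (λ ne e → ne (cong (_xor c) e))

  swapLayers-isAut : ∀ c → IsAut (DAdj _~_) (swapLayers c)
  swapLayers-isAut c =
    InAutΓ×AutK2⇒IsAut (swapLayers c) (↔-id V , (λ _ _ → ⇔-refl) , c , λ _ _ → refl)

  productForm⇒InAutΓ×AutK2 : ∀ φ {f c} → IsAut (DAdj _~_) φ
    → (∀ x i → to φ (x , i) ≡ (f x , i xor c)) → InAutΓ×AutK2 _~_ φ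
  productForm⇒InAutΓ×AutK2 φ {f} {c} φ-aut φ≗f×c = σ , σ-aut , c , φ≗f×c
    where
    f⁻¹ : V → V
    f⁻¹ y = proj₁ (from φ (y , c))

    σ : Perm V
    σ = mk↔ₛ′ f f⁻¹
      (λ y → cong proj₁ (trans (sym (φ≗f×c _ _)) (strictlyInverseˡ φ (y , c))))
      (λ x → cong proj₁ (trans (cong (from φ) (sym (φ≗f×c x false))) (strictlyInverseʳ φ (x , false))))

    images : ∀ u v → DAdj _~_ (to φ (u , false)) (to φ (v , true)) ⇔ f u ~ f v
    images u v rewrite φ≗f×c u false | φ≗f×c v true = ⇔-sym (DAdj-across c)

    σ-aut : IsAut _~_ σ
    σ-aut u v = ⇔-trans (DAdj-across false) (⇔-trans (φ-aut _ _) (images u v))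

  module _ (connected : Connected _~_) where

    invariant⇒constant : ∀ {B : Set} (f : V → B)
      → (∀ {x y} → x ~ y → f x ≡ f y) → ∀ x y → f x ≡ f y
    invariant⇒constant f invariant x y =
      fold (λ u v → f u ≡ f v) (λ u~v → trans (invariant u~v)) refl (connected x y)

    module _ (nonBipartite : ¬ Bipartite _~_) where

      doubleCoverInvariant⇒constant : (c : V × Bool → Bool)
        → (∀ {x y} i → x ~ y → c (x , i) ≡ c (y , not i)) → ∀ p q → c p ≡ c q
      doubleCoverInvariant⇒constant c invariant (x , i) (y , j) = begin
        c (x , i)      ≡⟨ layers-agree x i ⟩
        c (x , false)  ≡⟨ invariant⇒constant (λ z → c (z , false)) bottom-invariant x y ⟩
        c (y , false)  ≡⟨ layers-agree y j ⟨
        c (y , j)      ∎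
        where
        δ : V → Bool
        δ z = c (z , false) xor c (z , true)

        δ-invariant : ∀ {u v} → u ~ v → δ u ≡ δ v
        δ-invariant {u} {v} u~v = begin
          c (u , false) xor c (u , true)  ≡⟨ cong₂ _xor_ (invariant false u~v) (invariant true u~v) ⟩
          c (v , true) xor c (v , false)  ≡⟨ xor-comm (c (v , true)) (c (v , false)) ⟩
          δ v                             ∎

        -- If δ were true somewhere, it would be true everywhere and the bottom layer of c
        -- would properly 2-colour Γ.
        δ-false : ∀ z → δ z ≡ false
        δ-false z with δ z in δz≡
        ... | false = refl
        ... | true  = ⊥-elim (nonBipartite ((λ u → c (u , false)) , proper))
          where
          proper : ∀ u v → u ~ v → c (u , false) ≢ c (v , false)
          proper u v u~v same = not-¬ refl (begin
            true                            ≡⟨ δz≡ ⟨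
            δ z                             ≡⟨ invariant⇒constant δ δ-invariant z u ⟩
            c (u , false) xor c (u , true)  ≡⟨ cong₂ _xor_ same (invariant true u~v) ⟩
            c (v , false) xor c (v , false) ≡⟨ xor-same (c (v , false)) ⟩
            false                           ∎)

        layers-agree : ∀ z i → c (z , i) ≡ c (z , false)
        layers-agree z false = refl
        layers-agree z true  =
          sym (xor-cancelʳ-≡ (c (z , true)) _ _ (trans (δ-false z) (sym (xor-same (c (z , true))))))

        bottom-invariant : ∀ {u v} → u ~ v → c (u , false) ≡ c (v , false)
        bottom-invariant {u} {v} u~v = trans (invariant false u~v) (layers-agree v true)

      layerShift-constant : ∀ φ → IsAut (DAdj _~_) φ → ∀ p q → layerShift φ p ≡ layerShift φ q
      layerShift-constant φ φ-aut = doubleCoverInvariant⇒constant (layerShift φ) shift-invariant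
        where
        shift-invariant : ∀ {x y} i → x ~ y → layerShift φ (x , i) ≡ layerShift φ (y , not i)
        shift-invariant {x} {y} i x~y = begin
          a xor i      ≡⟨ cong (_xor i) (¬-not images-in-different-layers) ⟩
          not b xor i  ≡⟨ not-xor b i ⟩
          b xor not i  ∎
          where
          a b : Bool
          a = proj₂ (to φ (x , i))
          b = proj₂ (to φ (y , not i))
          images-in-different-layers : a ≢ b
          images-in-different-layers =
            proj₂ (Equivalence.to (φ-aut _ _) (Equivalence.to (DAdj-across i) x~y))

module _ (G : FinAbGroup) (S : Subset (FinAbGroup.order G)) where
  open FinAbGroup G using (_∙_; ε)

  private
    _~_ : V G → V G → Set
    _~_ = CayAdj G S

  InRιC2⇒InRι : ∀ φ {h b c} → (∀ x i → to φ (x , i) ≡ (ιpow G b x ∙ h , i xor c))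
    → InRι G (swapLayers c ↔-∘ φ)
  InRιC2⇒InRι φ {h} {b} {c} φ≗ = h , b , λ x i → begin
    to (swapLayers c) (to φ (x , i))  ≡⟨ cong (to (swapLayers c)) (φ≗ x i) ⟩
    ιpow G b x ∙ h , (i xor c) xor c  ≡⟨ cong (_ ,_) (xor-cancelʳ c i) ⟩
    ιpow G b x ∙ h , i                ∎

  InRι⇒InRιC2 : ∀ φ {k} → InRι G (swapLayers k ↔-∘ φ) → InRιC2 G φ
  InRι⇒InRιC2 φ {k} (h , b , ψ≗) = h , b , k , λ x i → begin
    to φ (x , i)                                       ≡⟨ swapLayers-involutive k (to φ (x , i)) ⟨
    to (swapLayers k) (to (swapLayers k ↔-∘ φ) (x , i)) ≡⟨ cong (to (swapLayers k)) (ψ≗ x i) ⟩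
    ιpow G b x ∙ h , i xor k                           ∎

  layerNormalised : Perm (V G × Bool) → Perm (V G × Bool)
  layerNormalised φ = swapLayers (layerShift φ (ε , false)) ↔-∘ φ

  layerNormalised-InB : Connected _~_ → ¬ Bipartite _~_ → ∀ φ → IsAut (DAdj _~_) φ
    → InB G S (layerNormalised φ)
  layerNormalised-InB connected nonBipartite φ φ-aut =
      IsAut-∘ {φ = φ} {ψ = swapLayers k} φ-aut (swapLayers-isAut k)
    , (λ g → keeps-layer (g , false))
    , (λ g → from-invariant ψ proj₂ keeps-layer (g , false))
    where
    k : Bool
    k = layerShift φ (ε , false)
    ψ : Perm (V G × Bool)
    ψ = layerNormalised φ
    keeps-layer : ∀ p → proj₂ (to ψ p) ≡ proj₂ p
    keeps-layer p = begin
      proj₂ (to φ p) xor k               ≡⟨ cong (proj₂ (to φ p) xor_) k-is-the-shift ⟩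
      proj₂ (to φ p) xor layerShift φ p  ≡⟨ xor-cancelˡ (proj₂ (to φ p)) (proj₂ p) ⟩
      proj₂ p                            ∎
      where
      k-is-the-shift : k ≡ layerShift φ p
      k-is-the-shift = layerShift-constant connected nonBipartite φ φ-aut (ε , false) p

lemma3p1 : (G : FinAbGroup) → (S : Subset (FinAbGroup.order G))
    → ExponentGt2 G
    → InverseClosed G S
    → Connected (CayAdj G S)
    → ¬ Bipartite (CayAdj G S)
    → TwinFree (CayAdj G S)
    → (∀ φ → InB G S φ → NormalisesR G φ)
    → (∀ φ → InB G S φ → InRι G φ)
    → (∀ φ → InRι G φ → InB G S φ)
    → ((∀ φ → IsAut (DAdj (CayAdj G S)) φ → InRιC2 G φ)
       × (∀ φ → InRιC2 G φ → IsAut (DAdj (CayAdj G S)) φ))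
      × Stable (CayAdj G S)
lemma3p1 G S _ _ connected nonBipartite _ _ B⊆Rι Rι⊆B =
  (aut⇒InRιC2 , InRιC2⇒aut) , (aut⇒InAutΓ×AutK2 , InAutΓ×AutK2⇒IsAut)
  where
  aut⇒InRιC2 : ∀ φ → IsAut (DAdj (CayAdj G S)) φ → InRιC2 G φ
  aut⇒InRιC2 φ φ-aut = InRι⇒InRιC2 G S φ
    (B⊆Rι (layerNormalised G S φ) (layerNormalised-InB G S connected nonBipartite φ φ-aut))

  InRιC2⇒aut : ∀ φ → InRιC2 G φ → IsAut (DAdj (CayAdj G S)) φ
  InRιC2⇒aut φ (h , b , c , φ≗) =
    IsAut-cancelˡ {φ = φ} {ψ = swapLayers c} (swapLayers-isAut c)
      (proj₁ (Rι⊆B (swapLayers c ↔-∘ φ) (InRιC2⇒InRι G S φ φ≗)))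

  aut⇒InAutΓ×AutK2 : ∀ φ → IsAut (DAdj (CayAdj G S)) φ → InAutΓ×AutK2 (CayAdj G S) φ
  aut⇒InAutΓ×AutK2 φ φ-aut with aut⇒InRιC2 φ φ-aut
  ... | h , b , c , φ≗ = productForm⇒InAutΓ×AutK2 φ φ-aut φ≗
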